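{- Let $q$ be a prime power and fix integers $r\ge 1$ and $k\ge 0$. As a function of $s$, the quantity $D_q(r,k,s)$ is non-decreasing.
   Context: For a matroid $M$ of rank $r$ and an integer $k\ge 0$, the $k$-dependence $d(M,k)$ is the proportion of the size-$(r-k)$ subsets of the ground set of $M$ that are dependent. For a matrix over $\mathbb{F}_q$, its subsets are subsets of its columns (the columns forming a multiset, so repeated columns are distinct elements), and its $k$-dependence is that of its column matroid. $D_q(r,k,s)$ denotes the smallest $d$ such that there exists a full-rank $r\times s$ matrix over $\mathbb{F}_q$ with $k$-dependence $\le d$; equivalently, the smallest $k$-dependence of any $\mathbb{F}_q$-representable rank-$r$ matroid with $s$ elements. -}

module Defs where

open import Level using (0ℓ)
open import Data.Nat using (ℕ; zero; suc; _^_)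
open import Data.Nat.Primality using (Prime)
open import Data.Fin using (Fin; zero; suc)
open import Data.Fin.Subset using (Subset; _∈_; _∉_; ∣_∣)
open import Data.List using (List; length)
import Data.List.Membership.Propositional as LMem
open import Data.List.Relation.Unary.Unique.Propositional using (Unique)
open import Data.Product using (Σ; ∃; _×_; _,_)
open import Relation.Binary.PropositionalEquality using (_≡_)
open import Relation.Nullary using (¬_)
open import Algebra.Bundles using (CommutativeRing)
open import Function.Bundles using (_⇔_)

IsPrimePower : ℕ → Set
IsPrimePower q = Σ ℕ λ p → Σ ℕ λ n → Prime p × q ≡ p ^ suc n

record FiniteField (q : ℕ) : Set₁ where
  field
    commRing : CommutativeRing 0ℓ 0ℓ
  open CommutativeRing commRing public
  field
    0≉1      : ¬ (0# ≈ 1#)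
    inverse  : ∀ x → ¬ (x ≈ 0#) → Σ Carrier λ y → x * y ≈ 1#
    enum     : Fin q → Carrier
    enum-inj : ∀ i j → enum i ≈ enum j → i ≡ j
    enum-sur : ∀ x → Σ (Fin q) λ i → enum i ≈ x

module _ {q : ℕ} (F : FiniteField q) where
  open FiniteField F using (Carrier; _≈_; _+_; _*_; 0#)

  -- r × s matrix over F: entry (row j, column i)
  Matrix : ℕ → ℕ → Set
  Matrix r s = Fin r → Fin s → Carrier

  ∑ : ∀ {n} → (Fin n → Carrier) → Carrier
  ∑ {zero}  f = 0#
  ∑ {suc n} f = f zero + ∑ (λ i → f (suc i))

  lincomb : ∀ {r s} → Matrix r s → (Fin s → Carrier) → Fin r → Carrier
  lincomb A c j = ∑ (λ i → c i * A j i)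

  FullRank : ∀ {r s} → Matrix r s → Set
  FullRank {r} {s} A = ∀ (v : Fin r → Carrier) →
    Σ (Fin s → Carrier) λ c → ∀ j → lincomb A c j ≈ v j

  Dependent : ∀ {r s} → Matrix r s → Subset s → Set
  Dependent {r} {s} A S = Σ (Fin s → Carrier) λ c →
      (∀ i → i ∉ S → c i ≈ 0#)
    × (Σ (Fin s) λ i → ¬ (c i ≈ 0#))
    × (∀ j → lincomb A c j ≈ 0#)

  NumDependent : ∀ {r s} → Matrix r s → ℕ → ℕ → Set
  NumDependent {r} {s} A m N = Σ (List (Subset s)) λ L →
      Unique L
    × (∀ S → (S LMem.∈ L) ⇔ ((∣ S ∣ ≡ m) × Dependent A S))
    × length L ≡ N

module Submission where

-- Put m = r - k. Let B be a full-rank r × t matrix over F = F_q whose columns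
-- contain N dependent m-sets. We delete t - s columns one at a time, keeping
-- full rank, so that the k-dependence N / C(t,m) never increases. For one
-- deletion from a matrix with n + 1 > r columns:
--   * a column that is not a coloop (it occurs in some linear relation) can be
--     deleted without losing rank, and such a column exists by pigeonhole;
--   * by double counting, a column lies on average in an m/(n+1) share of the
--     dependent m-sets, and a coloop lies in no more of them than any other
--     column (exchange argument); so some non-coloop e reaches the average;
--   * the dependent m-sets of B without e are those of B avoiding e, so their
--     number N' satisfies N'/C(n,m) ≤ N/C(n+1,m), because
--     C(n,m) / C(n+1,m) = (n+1-m) / (n+1).

open import Defs
open import Data.Nat using (ℕ)

module ListCounting {A : Set} where
  open import Data.Nat using (ℕ; suc; _+_; _≤_; s≤s; z≤n)
  open import Data.Nat.Properties using (+-suc; ≤-trans; ≤-reflexive)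
  open import Data.Bool using (true; false; if_then_else_)
  open import Data.List using (List; []; _∷_; _++_; [_]; length; filter; map)
  open import Data.List.Properties using (length-++)
  open import Data.List.Membership.Propositional using () renaming (_∈_ to _∈ₗ_)
  open import Data.List.Membership.Propositional.Properties using (∈-∃++; ∈-++⁻; ∈-++⁺ˡ; ∈-++⁺ʳ; ∈-filter⁺; ∈-filter⁻; ∈-map⁻)
  open import Data.List.Relation.Unary.Any using (here; there)
  import Data.List.Relation.Unary.All as All
  open import Data.List.Relation.Unary.AllPairs using ([]; _∷_)
  open import Data.List.Relation.Unary.Unique.Propositional using (Unique)
  open import Data.List.Relation.Unary.Unique.Propositional.Properties using (filter⁺)
  open import Data.Product using (_,_)
  open import Data.Sum using (inj₁; inj₂)
  open import Data.Empty using (⊥-elim)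
  open import Function using (id)
  open import Relation.Nullary using (does)
  open import Relation.Unary using (Decidable)
  open import Relation.Unary.Properties using (∁?)
  open import Relation.Binary.PropositionalEquality using (_≡_; _≢_; refl; sym; trans; cong)

  indicator : {P : A → Set} → Decidable P → A → ℕ
  indicator P? x = if does (P? x) then 1 else 0

  length-filter-∷ : {P : A → Set} (P? : Decidable P) (x : A) (xs : List A) →
    length (filter P? (x ∷ xs)) ≡ indicator P? x + length (filter P? xs)
  length-filter-∷ P? x xs with does (P? x)
  ... | true  = refl
  ... | false = refl

  length-filter-split : {P : A → Set} (P? : Decidable P) (xs : List A) →
    length (filter P? xs) + length (filter (∁? P?) xs) ≡ length xs
  length-filter-split P? [] = refl
  length-filter-split P? (x ∷ xs) with does (P? x)
  ... | true  = cong suc (length-filter-split P? xs)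
  ... | false = trans (+-suc _ _) (cong suc (length-filter-split P? xs))

  length-≤-injection : {B : Set} (g : A → B) (xs : List A) (ys : List B) → Unique xs →
    (∀ {x} → x ∈ₗ xs → g x ∈ₗ ys) →
    (∀ {x y} → x ∈ₗ xs → y ∈ₗ xs → g x ≡ g y → x ≡ y) →
    length xs ≤ length ys
  length-≤-injection g [] ys _ _ _ = z≤n
  length-≤-injection g (x ∷ xs) ys (x∉xs ∷ uxs) into inj
    with as , bs , refl ← ∈-∃++ (into (here refl)) =
    ≤-trans (s≤s shorter) (≤-reflexive (sym length-removed))
    where
    into' : ∀ {y} → y ∈ₗ xs → g y ∈ₗ as ++ bs
    into' {y} y∈ with ∈-++⁻ as (into (there y∈))
    ... | inj₁ i         = ∈-++⁺ˡ i
    ... | inj₂ (here e)  = ⊥-elim (All.lookup x∉xs y∈ (sym (inj (there y∈) (here refl) e)))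
    ... | inj₂ (there i) = ∈-++⁺ʳ as i
    shorter : length xs ≤ length (as ++ bs)
    shorter = length-≤-injection g xs (as ++ bs) uxs into' (λ x∈ y∈ → inj (there x∈) (there y∈))
    length-removed : length (as ++ [ g x ] ++ bs) ≡ suc (length (as ++ bs))
    length-removed = trans (length-++ as) (trans (+-suc _ _) (cong suc (sym (length-++ as))))

  length-filter-filter-≤ : {P Q : A → Set} (P? : Decidable P) (Q? : Decidable Q) (xs : List A) →
    Unique xs → length (filter Q? (filter P? xs)) ≤ length (filter P? (filter Q? xs))
  length-filter-filter-≤ P? Q? xs unique =
    length-≤-injection id _ _ (filter⁺ Q? (filter⁺ P? unique)) into (λ _ _ eq → eq)
    where
    into : ∀ {x} → x ∈ₗ filter Q? (filter P? xs) → x ∈ₗ filter P? (filter Q? xs)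
    into x∈ with x∈' , Qx ← ∈-filter⁻ Q? {xs = filter P? xs} x∈
            with x∈xs , Px ← ∈-filter⁻ P? {xs = xs} x∈' =
      ∈-filter⁺ P? {xs = filter Q? xs} (∈-filter⁺ Q? x∈xs Qx) Px

  unique-map : {B : Set} (g : A → B) (xs : List A) → Unique xs →
    (∀ {x y} → x ∈ₗ xs → y ∈ₗ xs → g x ≡ g y → x ≡ y) → Unique (map g xs)
  unique-map g []       _              _   = []
  unique-map g (x ∷ xs) (x∉xs ∷ uxs) inj =
    All.tabulate gx∉ ∷ unique-map g xs uxs (λ x∈ y∈ → inj (there x∈) (there y∈))
    where
    gx∉ : ∀ {z} → z ∈ₗ map g xs → g x ≢ z
    gx∉ z∈ gx≡z with y , y∈ , refl ← ∈-map⁻ g z∈ =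
      All.lookup x∉xs y∈ (inj (here refl) (there y∈) gx≡z)

open ListCounting

module Subsets where
  open import Data.Nat using (ℕ; zero; suc)
  open import Data.Fin using (Fin; zero; suc; punchIn; _≟_)
  open import Data.Fin.Subset using (Subset; inside; outside; _∈_; _∉_; _⊆_; ∣_∣)
  open import Data.Fin.Subset.Properties using (⊆-antisym)
  open import Data.Vec using (_∷_; insertAt; removeAt; lookup; _[_]≔_; here; there)
  open import Data.Vec.Properties using (insertAt-removeAt; insertAt-punchIn; insertAt-lookup; []=⇒lookup; lookup⇒[]=; []=-injective; []≔-updates; []≔-minimal; lookup∘update′)
  open import Data.Empty using (⊥-elim)
  open import Function using (_∘_)
  open import Relation.Nullary using (yes; no)
  open import Relation.Binary.PropositionalEquality using (_≡_; _≢_; refl; sym; trans; cong; subst)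

  private
    variable
      n : ℕ
      x e f : Fin n
      S S' : Subset n

  ∣remove∣ : x ∈ S → suc ∣ S [ x ]≔ outside ∣ ≡ ∣ S ∣
  ∣remove∣ here = refl
  ∣remove∣ {S = inside  ∷ S} (there x∈S) = cong suc (∣remove∣ x∈S)
  ∣remove∣ {S = outside ∷ S} (there x∈S) = ∣remove∣ x∈S

  ∣add∣ : x ∉ S → ∣ S [ x ]≔ inside ∣ ≡ suc ∣ S ∣
  ∣add∣ {x = zero}  {S = inside  ∷ S} x∉S = ⊥-elim (x∉S here)
  ∣add∣ {x = zero}  {S = outside ∷ S} x∉S = refl
  ∣add∣ {x = suc x} {S = inside  ∷ S} x∉S = cong suc (∣add∣ (x∉S ∘ there))
  ∣add∣ {x = suc x} {S = outside ∷ S} x∉S = ∣add∣ (x∉S ∘ there)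

  ∈-insertAt⁺ : ∀ {S : Subset n} {e i b} → i ∈ S → punchIn e i ∈ insertAt S e b
  ∈-insertAt⁺ {S = S} {e} {i} {b} i∈S =
    lookup⇒[]= _ _ (trans (insertAt-punchIn S e b i) ([]=⇒lookup i∈S))

  ∈-insertAt⁻ : ∀ {S : Subset n} {e i b} → punchIn e i ∈ insertAt S e b → i ∈ S
  ∈-insertAt⁻ {S = S} {e} {i} {b} h =
    lookup⇒[]= _ _ (trans (sym (insertAt-punchIn S e b i)) ([]=⇒lookup h))

  ∉-insertAt : ∀ {S : Subset n} {e} → e ∉ insertAt S e outside
  ∉-insertAt {S = S} {e} h with () ← trans (sym (insertAt-lookup S e outside)) ([]=⇒lookup h)

  ∣insertAt-outside∣ : (S : Subset n) (e : Fin (suc n)) → ∣ insertAt S e outside ∣ ≡ ∣ S ∣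
  ∣insertAt-outside∣ S           zero    = refl
  ∣insertAt-outside∣ (inside ∷ S)  (suc e) = cong suc (∣insertAt-outside∣ S e)
  ∣insertAt-outside∣ (outside ∷ S) (suc e) = ∣insertAt-outside∣ S e

  insertAt-removeAt-∉ : ∀ {S : Subset (suc n)} {e} → e ∉ S → insertAt (removeAt S e) e outside ≡ S
  insertAt-removeAt-∉ {S = S} {e} e∉S with lookup S e in eq
  ... | inside  = ⊥-elim (e∉S (lookup⇒[]= e S eq))
  ... | outside = trans (cong (insertAt (removeAt S e) e) (sym eq)) (insertAt-removeAt S e)

  exchange : Fin n → Fin n → Subset n → Subset n
  exchange e f S = (S [ e ]≔ outside) [ f ]≔ inside

  module _ (e≢f : e ≢ f) where

    ∣exchange∣ : e ∈ S → f ∉ S → ∣ exchange e f S ∣ ≡ ∣ S ∣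
    ∣exchange∣ {S = S} e∈S f∉S = trans (∣add∣ f∉S-e) (∣remove∣ e∈S)
      where
      f∉S-e : f ∉ S [ e ]≔ outside
      f∉S-e h = f∉S (lookup⇒[]= _ _ (trans (sym (lookup∘update′ (e≢f ∘ sym) S outside)) ([]=⇒lookup h)))

    f∈exchange : f ∈ exchange e f S
    f∈exchange {S = S} = []≔-updates (S [ e ]≔ outside) f

    e∉exchange : e ∉ exchange e f S
    e∉exchange {S = S} h with () ← []=-injective ([]≔-minimal _ e f e≢f ([]≔-updates S e)) h

    ∈-exchange⁺ : x ≢ e → x ≢ f → x ∈ S → x ∈ exchange e f S
    ∈-exchange⁺ {S = S} x≢e x≢f = []≔-minimal _ _ f x≢f ∘ []≔-minimal S _ e x≢e

    ∈-exchange⁻ : x ≢ e → x ≢ f → x ∈ exchange e f S → x ∈ S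
    ∈-exchange⁻ {S = S} x≢e x≢f h = lookup⇒[]= _ _ (trans (sym unchanged) ([]=⇒lookup h))
      where
      unchanged : lookup (exchange e f S) _ ≡ lookup S _
      unchanged = trans (lookup∘update′ x≢f (S [ e ]≔ outside) inside) (lookup∘update′ x≢e S outside)

    exchange-injective : e ∈ S → e ∈ S' → f ∉ S → f ∉ S' →
      exchange e f S ≡ exchange e f S' → S ≡ S'
    exchange-injective e∈S e∈S' f∉S f∉S' eq =
      ⊆-antisym (included e∈S' f∉S eq) (included e∈S f∉S' (sym eq))
      where
      included : ∀ {S S'} → e ∈ S' → f ∉ S → exchange e f S ≡ exchange e f S' → S ⊆ S'
      included {S} {S'} e∈S' f∉S eq {x} x∈S with x ≟ e | x ≟ f
      ... | yes refl | _        = e∈S'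
      ... | no _     | yes refl = ⊥-elim (f∉S x∈S)
      ... | no x≢e   | no x≢f   =
        ∈-exchange⁻ x≢e x≢f (subst (x ∈_) eq (∈-exchange⁺ x≢e x≢f x∈S))

open Subsets

module DoubleCounting where
  open import Data.Nat using (ℕ; zero; suc; _+_; _*_; _≤_; z≤n)
  open import Data.Nat.Properties using (+-0-commutativeMonoid; +-mono-≤)
  open import Data.Fin using (Fin; zero; suc)
  open import Data.Fin.Subset using (Subset; inside; outside; ∣_∣)
  open import Data.Fin.Subset.Properties using (_∈?_)
  open import Data.Vec using (_∷_; [])
  open import Data.List using (List; []; _∷_; length; filter)
  open import Data.List.Membership.Propositional using () renaming (_∈_ to _∈ₗ_)
  open import Data.List.Relation.Unary.Any using (here; there)
  open import Relation.Binary.PropositionalEquality using (_≡_; refl; trans; cong; cong₂; module ≡-Reasoning)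
  open import Algebra.Properties.CommutativeMonoid.Sum +-0-commutativeMonoid using (sum; ∑-distrib-+; sum-cong-≗; sum-replicate-zero)

  ∑-indicator-∈ : ∀ {n} (S : Subset n) → sum (λ e → indicator (e ∈?_) S) ≡ ∣ S ∣
  ∑-indicator-∈ []             = refl
  ∑-indicator-∈ (inside ∷ S)  = cong suc (∑-indicator-∈ S)
  ∑-indicator-∈ (outside ∷ S) = ∑-indicator-∈ S

  double-counting : ∀ {n m} (L : List (Subset n)) → (∀ {S} → S ∈ₗ L → ∣ S ∣ ≡ m) →
    sum (λ e → length (filter (e ∈?_) L)) ≡ length L * m
  double-counting {n} [] _ = sum-replicate-zero n
  double-counting {m = m} (S ∷ L) size = begin
    sum (λ e → length (filter (e ∈?_) (S ∷ L)))
      ≡⟨ sum-cong-≗ (λ e → length-filter-∷ (e ∈?_) S L) ⟩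
    sum (λ e → indicator (e ∈?_) S + length (filter (e ∈?_) L))
      ≡⟨ ∑-distrib-+ (λ e → indicator (e ∈?_) S) (λ e → length (filter (e ∈?_) L)) ⟩
    sum (λ e → indicator (e ∈?_) S) + sum (λ e → length (filter (e ∈?_) L))
      ≡⟨ cong₂ _+_ (trans (∑-indicator-∈ S) (size (here refl)))
                   (double-counting L (λ S∈ → size (there S∈))) ⟩
    m + length L * m
      ∎
    where open ≡-Reasoning

  sum-≤ : ∀ {n} (f : Fin n → ℕ) {a} → (∀ x → f x ≤ a) → sum f ≤ n * a
  sum-≤ {zero}  f bound = z≤n
  sum-≤ {suc n} f bound = +-mono-≤ (bound zero) (sum-≤ (λ i → f (suc i)) (λ i → bound (suc i)))

open DoubleCounting

module BinomialRatios where
  open import Data.Nat using (zero; suc; _+_; _*_; _≤_; _<_; s≤s; z≤n)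
  open import Data.Nat.Properties using (≤-trans; m≤m+n; +-comm; +-identityʳ; *-zeroʳ; *-identityʳ; *-distribˡ-+; *-cancelˡ-≤; +-cancelʳ-≤; *-monoˡ-≤; *-monoʳ-≤; +-monoʳ-≤; module ≤-Reasoning)
  open import Data.Nat.Combinatorics using (_C_; nC1≡n; nCk+nC[k+1]≡[n+1]C[k+1])
  open import Data.Nat.Solver using (module +-*-Solver)
  open import Relation.Binary.PropositionalEquality using (_≡_; refl; sym; trans; cong; cong₂; module ≡-Reasoning)
  open +-*-Solver using (solve; _:+_; _:*_; _:=_; con)

  pascal : ∀ n k → suc n C suc k ≡ n C k + n C suc k
  pascal n k = sym (nCk+nC[k+1]≡[n+1]C[k+1] n k)

  C-positive : ∀ {n k} → k ≤ n → 0 < n C k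
  C-positive {n}     {zero}  _         = s≤s z≤n
  C-positive {suc n} {suc k} (s≤s k≤n) rewrite pascal n k = ≤-trans (C-positive k≤n) (m≤m+n _ _)

  C-absorption : ∀ n k → suc k * (suc n C suc k) ≡ suc n * (n C k)
  C-absorption zero    zero    = refl
  C-absorption zero    (suc k) = *-zeroʳ (suc (suc k))
  C-absorption (suc n) zero    rewrite nC1≡n (suc (suc n)) = trans (+-identityʳ _) (sym (*-identityʳ _))
  C-absorption (suc n) (suc k) = begin
    suc (suc k) * (suc (suc n) C suc (suc k))
      ≡⟨ cong (suc (suc k) *_) (pascal (suc n) (suc k)) ⟩
    suc (suc k) * (a + b)
      ≡⟨ solve 3 (λ k a b → (con 2 :+ k) :* (a :+ b) := (con 1 :+ k) :* a :+ a :+ (con 2 :+ k) :* b) refl k a b ⟩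
    suc k * a + a + suc (suc k) * b
      ≡⟨ cong₂ (λ x y → x + a + y) (C-absorption n k) (C-absorption n (suc k)) ⟩
    suc n * c + a + suc n * d
      ≡⟨ cong (λ z → suc n * c + z + suc n * d) (pascal n k) ⟩
    suc n * c + (c + d) + suc n * d
      ≡⟨ solve 3 (λ n c d → (con 1 :+ n) :* c :+ (c :+ d) :+ (con 1 :+ n) :* d := (con 2 :+ n) :* (c :+ d)) refl n c d ⟩
    suc (suc n) * (c + d)
      ≡⟨ cong (suc (suc n) *_) (sym (pascal n k)) ⟩
    suc (suc n) * (suc n C suc k)
      ∎
    where
    open ≡-Reasoning
    a = suc n C suc k
    b = suc n C suc (suc k)
    c = n C k
    d = n C suc k

  -- C(n,k) / C(n+1,k) = (n+1-k)/(n+1), written without division.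
  C-deletion : ∀ n k → suc n * (n C k) + k * (suc n C k) ≡ suc n * (suc n C k)
  C-deletion n zero    = +-identityʳ _
  C-deletion n (suc k) = begin
    suc n * (n C suc k) + suc k * (suc n C suc k)  ≡⟨ cong (suc n * (n C suc k) +_) (C-absorption n k) ⟩
    suc n * (n C suc k) + suc n * (n C k)          ≡⟨ sym (*-distribˡ-+ (suc n) (n C suc k) (n C k)) ⟩
    suc n * (n C suc k + n C k)                    ≡⟨ cong (suc n *_) (trans (+-comm (n C suc k) (n C k)) (sym (pascal n k))) ⟩
    suc n * (suc n C suc k)                        ∎
    where open ≡-Reasoning

  -- Fractions compared by cross-multiplication: a/x ≤ b/y ≤ c/z gives a/x ≤ c/z
  -- (the middle denominator must be positive).
  ratio-trans : ∀ {a b c x y z} → 0 < y → a * y ≤ b * x → b * z ≤ c * y → a * z ≤ c * x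
  ratio-trans {a} {b} {c} {x} {suc y} {z} _ a/x≤b/y b/y≤c/z = *-cancelˡ-≤ (suc y) (begin
    suc y * (a * z)  ≡⟨ solve 3 (λ y a z → y :* (a :* z) := a :* y :* z) refl (suc y) a z ⟩
    a * suc y * z    ≤⟨ *-monoˡ-≤ z a/x≤b/y ⟩
    b * x * z        ≡⟨ solve 3 (λ b x z → b :* x :* z := x :* (b :* z)) refl b x z ⟩
    x * (b * z)      ≤⟨ *-monoʳ-≤ x b/y≤c/z ⟩
    x * (c * suc y)  ≡⟨ solve 3 (λ x c y → x :* (c :* y) := y :* (c :* x)) refl x c (suc y) ⟩
    suc y * (c * x)  ∎)
    where open ≤-Reasoning

  -- Deleting one of n+1 columns that lies in a ≥ m/(n+1) share of the N = a + N'
  -- dependent m-sets leaves N' of them, and N'/C(n,m) ≤ N/C(n+1,m).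
  deletion-ratio : ∀ n m a N' → (a + N') * m ≤ suc n * a →
    N' * (suc n C m) ≤ (a + N') * (n C m)
  deletion-ratio n m a N' share = *-cancelˡ-≤ (suc n) (+-cancelʳ-≤ (suc n * a * X) _ _ (begin
    suc n * (N' * X) + suc n * a * X
      ≡⟨ solve 4 (λ t a n x → t :* (n :* x) :+ t :* a :* x := (a :+ n) :* (t :* x)) refl (suc n) a N' X ⟩
    N * (suc n * X)
      ≡⟨ cong (N *_) (sym (C-deletion n m)) ⟩
    N * (suc n * Y + m * X)
      ≡⟨ solve 5 (λ b t y m x → b :* (t :* y :+ m :* x) := t :* (b :* y) :+ b :* m :* x) refl N (suc n) Y m X ⟩
    suc n * (N * Y) + N * m * X
      ≤⟨ +-monoʳ-≤ (suc n * (N * Y)) (*-monoˡ-≤ X share) ⟩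
    suc n * (N * Y) + suc n * a * X
      ∎))
    where
    open ≤-Reasoning
    N = a + N'
    X = suc n C m
    Y = n C m

open BinomialRatios

module FinFacts where
  open import Data.Nat using (zero; suc; _<_; s≤s; z≤n)
  open import Data.Fin using (Fin; zero; suc; punchIn; punchOut; funToFin; combine; _≟_)
  open import Data.Fin.Properties using (punchIn-punchOut)
  open import Data.Product using (∃; _,_)
  open import Data.Sum using (_⊎_; inj₁; inj₂)
  open import Data.Empty using (⊥-elim)
  open import Function using (_∘_)
  open import Relation.Nullary using (yes; no)
  open import Relation.Binary.PropositionalEquality using (_≡_; _≢_; refl; sym; cong₂)

  ≡-or-punchIn : ∀ {n} (e x : Fin (suc n)) → x ≡ e ⊎ ∃ λ i → punchIn e i ≡ x
  ≡-or-punchIn e x with e ≟ x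
  ... | yes e≡x = inj₁ (sym e≡x)
  ... | no  e≢x = inj₂ (punchOut e≢x , punchIn-punchOut e≢x)

  distinct⇒1< : ∀ {n} {a b : Fin n} → a ≢ b → 1 < n
  distinct⇒1< {suc zero}    {zero} {zero} a≢b = ⊥-elim (a≢b refl)
  distinct⇒1< {suc (suc n)} _                = s≤s (s≤s z≤n)

  -- funToFin respects pointwise equality (there is no function extensionality).
  funToFin-cong : ∀ {m n} {f g : Fin m → Fin n} → (∀ x → f x ≡ g x) → funToFin f ≡ funToFin g
  funToFin-cong {zero}  f≗g = refl
  funToFin-cong {suc m} f≗g = cong₂ combine (f≗g zero) (funToFin-cong (f≗g ∘ suc))

open FinFacts

module LinearAlgebra {q : ℕ} (F : FiniteField q) where
  open import Data.Nat using (ℕ; zero; suc; _<_; _^_)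
  open import Data.Nat.Properties using (^-monoʳ-<)
  open import Data.Fin using (Fin; zero; suc; punchIn; funToFin; finToFun)
  import Data.Fin as Fin
  open import Data.Fin.Properties using (pigeonhole; ¬∀⟶∃¬; any?; all?; <⇒≢; funToFin-finToFin; finToFun-funToFin)
  open import Data.Fin.Subset using (Subset; outside; _∉_)
  open import Data.Vec using (insertAt)
  open import Data.Vec.Functional as Vector using (removeAt)
  open import Data.Vec.Functional.Properties using (insertAt-lookup; insertAt-punchIn)
  open import Data.Product using (Σ; ∃; _×_; _,_; proj₁; proj₂)
  open import Data.Sum using (_⊎_; inj₁; inj₂)
  open import Data.Empty using (⊥-elim)
  open import Function using (_∘_)
  open import Relation.Nullary using (¬_; Dec; yes; no)
  open import Relation.Nullary.Decidable using (_×-dec_; ¬?)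
  open import Relation.Binary.PropositionalEquality as ≡ using (_≡_; _≢_)

  open FiniteField F hiding (zero)
    renaming (refl to ≈-refl; sym to ≈-sym; trans to ≈-trans; reflexive to ≈-reflexive)
  open import Algebra.Properties.Semiring.Sum semiring using (sum; sum-remove; ∑-distrib-+; sum-cong-≋; *-distribˡ-sum)
  open import Algebra.Properties.Ring ring using (-‿distribˡ-*; -1*x≈-x)
  open import Algebra.Properties.AbelianGroup +-abelianGroup using (x∙y⁻¹≈ε⇒x≈y; x≈y⇒x∙y⁻¹≈ε)
  open import Relation.Binary.Reasoning.Setoid setoid

  index : Carrier → Fin q
  index x = proj₁ (enum-sur x)

  enum-index : ∀ x → enum (index x) ≈ x
  enum-index x = proj₂ (enum-sur x)

  index-cong : ∀ {x y} → x ≈ y → index x ≡ index y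
  index-cong {x} {y} x≈y = enum-inj _ _ (≈-trans (enum-index x) (≈-trans x≈y (≈-sym (enum-index y))))

  index-injective : ∀ {x y} → index x ≡ index y → x ≈ y
  index-injective {x} {y} eq =
    ≈-trans (≈-sym (enum-index x)) (≈-trans (≈-reflexive (≡.cong enum eq)) (enum-index y))

  _≈?_ : ∀ x y → Dec (x ≈ y)
  x ≈? y with index x Fin.≟ index y
  ... | yes eq = yes (index-injective eq)
  ... | no  ne = no (ne ∘ index-cong)

  1<q : 1 < q
  1<q = distinct⇒1< (0≉1 ∘ index-injective)

  -- The sum ∑ of the definitions is the library's monoid sum, whose lemmas
  -- (splitting off a term, additivity, scaling) we reuse.
  ∑≡sum : ∀ {n} (f : Fin n → Carrier) → ∑ F f ≡ sum f
  ∑≡sum {zero}  f = ≡.refl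
  ∑≡sum {suc n} f = ≡.cong (f zero +_) (∑≡sum (f ∘ suc))

  private variable r n : ℕ

  lincomb≡sum : (A : Matrix F r n) (c : Fin n → Carrier) →
    ∀ j → lincomb F A c j ≡ sum (λ i → c i * A j i)
  lincomb≡sum A c j = ∑≡sum (λ i → c i * A j i)

  lincomb-cong : (A : Matrix F r n) {c d : Fin n → Carrier} → (∀ i → c i ≈ d i) →
    ∀ j → lincomb F A c j ≈ lincomb F A d j
  lincomb-cong A {c} {d} c≈d j = begin
    lincomb F A c j          ≡⟨ lincomb≡sum A c j ⟩
    sum (λ i → c i * A j i)  ≈⟨ sum-cong-≋ (λ i → *-congʳ (c≈d i)) ⟩
    sum (λ i → d i * A j i)  ≡⟨ lincomb≡sum A d j ⟨
    lincomb F A d j          ∎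

  lincomb-+* : (A : Matrix F r n) (d : Fin n → Carrier) (a : Carrier) (c : Fin n → Carrier) →
    ∀ j → lincomb F A (λ i → d i + a * c i) j ≈ lincomb F A d j + a * lincomb F A c j
  lincomb-+* A d a c j = begin
    lincomb F A (λ i → d i + a * c i) j
      ≡⟨ lincomb≡sum A _ j ⟩
    sum (λ i → (d i + a * c i) * A j i)
      ≈⟨ sum-cong-≋ (λ i → ≈-trans (distribʳ (A j i) (d i) (a * c i))
                                   (+-congˡ (*-assoc a (c i) (A j i)))) ⟩
    sum (λ i → d i * A j i + a * (c i * A j i))
      ≈⟨ ∑-distrib-+ (λ i → d i * A j i) (λ i → a * (c i * A j i)) ⟩
    sum (λ i → d i * A j i) + sum (λ i → a * (c i * A j i))
      ≈⟨ +-congˡ (≈-sym (*-distribˡ-sum a (λ i → c i * A j i))) ⟩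
    sum (λ i → d i * A j i) + a * sum (λ i → c i * A j i)
      ≡⟨ ≡.cong₂ (λ x y → x + a * y) (lincomb≡sum A d j) (lincomb≡sum A c j) ⟨
    lincomb F A d j + a * lincomb F A c j
      ∎

  deleteColumn : Matrix F r (suc n) → Fin (suc n) → Matrix F r n
  deleteColumn A e j = Vector.removeAt (A j) e

  lincomb-deleteColumn : (A : Matrix F r (suc n)) (e : Fin (suc n)) (c : Fin (suc n) → Carrier) →
    c e ≈ 0# → ∀ j → lincomb F A c j ≈ lincomb F (deleteColumn A e) (Vector.removeAt c e) j
  lincomb-deleteColumn A e c ce≈0 j = begin
    lincomb F A c j
      ≡⟨ lincomb≡sum A c j ⟩
    sum (λ i → c i * A j i)
      ≈⟨ sum-remove {i = e} (λ i → c i * A j i) ⟩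
    c e * A j e + sum (Vector.removeAt (λ i → c i * A j i) e)
      ≈⟨ +-congʳ (≈-trans (*-congʳ ce≈0) (zeroˡ (A j e))) ⟩
    0# + sum (Vector.removeAt (λ i → c i * A j i) e)
      ≈⟨ +-identityˡ _ ⟩
    sum (Vector.removeAt (λ i → c i * A j i) e)
      ≡⟨ lincomb≡sum (deleteColumn A e) (Vector.removeAt c e) j ⟨
    lincomb F (deleteColumn A e) (Vector.removeAt c e) j
      ∎

  lincomb-insertAt : (A : Matrix F r (suc n)) (e : Fin (suc n)) (c : Fin n → Carrier) →
    ∀ j → lincomb F A (Vector.insertAt c e 0#) j ≈ lincomb F (deleteColumn A e) c j
  lincomb-insertAt A e c j = begin
    lincomb F A (Vector.insertAt c e 0#) j
      ≈⟨ lincomb-deleteColumn A e (Vector.insertAt c e 0#) (≈-reflexive (insertAt-lookup c e 0#)) j ⟩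
    lincomb F (deleteColumn A e) (Vector.removeAt (Vector.insertAt c e 0#) e) j
      ≈⟨ lincomb-cong (deleteColumn A e) (λ i → ≈-reflexive (insertAt-punchIn c e 0# i)) j ⟩
    lincomb F (deleteColumn A e) c j
      ∎

  dependent-deleteColumn⁺ : (A : Matrix F r (suc n)) (e : Fin (suc n)) (S' : Subset n) →
    Dependent F A (insertAt S' e outside) → Dependent F (deleteColumn A e) S'
  dependent-deleteColumn⁺ A e S' (c , support , (x , cx≉0) , relation) =
    Vector.removeAt c e , support' , nonzero (≡-or-punchIn e x) ,
    λ j → ≈-trans (≈-sym (lincomb-deleteColumn A e c ce≈0 j)) (relation j)
    where
    ce≈0 : c e ≈ 0#
    ce≈0 = support e ∉-insertAt
    support' : ∀ i → i ∉ S' → c (punchIn e i) ≈ 0#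
    support' i i∉S' = support (punchIn e i) (i∉S' ∘ ∈-insertAt⁻)
    nonzero : (x ≡ e ⊎ ∃ λ i → punchIn e i ≡ x) → ∃ λ i → ¬ (c (punchIn e i) ≈ 0#)
    nonzero (inj₁ ≡.refl)       = ⊥-elim (cx≉0 ce≈0)
    nonzero (inj₂ (i , ≡.refl)) = i , cx≉0

  dependent-deleteColumn⁻ : (A : Matrix F r (suc n)) (e : Fin (suc n)) (S' : Subset n) →
    Dependent F (deleteColumn A e) S' → Dependent F A (insertAt S' e outside)
  dependent-deleteColumn⁻ A e S' (c , support , (i , ci≉0) , relation) =
    Vector.insertAt c e 0# , (λ x → support' x (≡-or-punchIn e x)) ,
    (punchIn e i , λ h → ci≉0 (≈-trans (≈-reflexive (≡.sym (insertAt-punchIn c e 0# i))) h)) ,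
    λ j → ≈-trans (lincomb-insertAt A e c j) (relation j)
    where
    support' : ∀ x → (x ≡ e ⊎ ∃ λ i → punchIn e i ≡ x) →
      x ∉ insertAt S' e outside → Vector.insertAt c e 0# x ≈ 0#
    support' x (inj₁ ≡.refl)       _   = ≈-reflexive (insertAt-lookup c e 0#)
    support' x (inj₂ (i , ≡.refl)) x∉S =
      ≈-trans (≈-reflexive (insertAt-punchIn c e 0# i)) (support i (x∉S ∘ ∈-insertAt⁺))

  NonColoop : Matrix F r n → Fin n → Set
  NonColoop A e = Σ (_ → Carrier) λ c → ¬ (c e ≈ 0#) × (∀ j → lincomb F A c j ≈ 0#)

  -- Every relation vanishes at a coloop e; so a dependent set stays dependent
  -- when e is exchanged for another column f.
  dependent-exchange : (A : Matrix F r n) {e f : Fin n} {S : Subset n} →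
    ¬ NonColoop A e → e ≢ f → Dependent F A S → Dependent F A (exchange e f S)
  dependent-exchange A {e} {f} {S} coloop e≢f (c , support , nonzero , relation) =
    c , support' , nonzero , relation
    where
    ce≈0 : c e ≈ 0#
    ce≈0 with c e ≈? 0#
    ... | yes ce≈0 = ce≈0
    ... | no  ce≉0 = ⊥-elim (coloop (c , ce≉0 , relation))
    support' : ∀ x → x ∉ exchange e f S → c x ≈ 0#
    support' x x∉ with x Fin.≟ e | x Fin.≟ f
    ... | yes ≡.refl | _          = ce≈0
    ... | no _       | yes ≡.refl = ⊥-elim (x∉ (f∈exchange e≢f))
    ... | no x≢e     | no x≢f     = support x (x∉ ∘ ∈-exchange⁺ e≢f x≢e x≢f)

  -- Deleting a non-coloop keeps the column space: subtract the multiple of the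
  -- relation that cancels the coefficient of column e.
  fullRank-deleteColumn : (A : Matrix F r (suc n)) (e : Fin (suc n)) →
    FullRank F A → NonColoop A e → FullRank F (deleteColumn A e)
  fullRank-deleteColumn A e fullRank (c , ce≉0 , relation) v =
    Vector.removeAt d' e , λ j → ≈-trans (≈-sym (lincomb-deleteColumn A e d' d'e≈0 j)) (d'↦v j)
    where
    d = proj₁ (fullRank v)
    y = proj₁ (inverse (c e) ce≉0)
    λ' = d e * y
    d' : Fin _ → Carrier
    d' i = d i + (- λ') * c i
    d'↦v : ∀ j → lincomb F A d' j ≈ v j
    d'↦v j = begin
      lincomb F A d' j
        ≈⟨ lincomb-+* A d (- λ') c j ⟩
      lincomb F A d j + (- λ') * lincomb F A c j
        ≈⟨ +-cong (proj₂ (fullRank v) j) (≈-trans (*-congˡ (relation j)) (zeroʳ _)) ⟩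
      v j + 0#
        ≈⟨ +-identityʳ (v j) ⟩
      v j
        ∎
    d'e≈0 : d' e ≈ 0#
    d'e≈0 = begin
      d e + (- λ') * c e    ≈⟨ +-congˡ (≈-sym (-‿distribˡ-* λ' (c e))) ⟩
      d e + - (λ' * c e)    ≈⟨ +-congˡ (-‿cong (begin
        d e * y * c e         ≈⟨ *-assoc (d e) y (c e) ⟩
        d e * (y * c e)       ≈⟨ *-congˡ (≈-trans (*-comm y (c e)) (proj₂ (inverse (c e) ce≉0))) ⟩
        d e * 1#              ≈⟨ *-identityʳ (d e) ⟩
        d e                   ∎)) ⟩
      d e + - d e           ≈⟨ -‿inverseʳ (d e) ⟩
      0#                    ∎

  decode : Fin (q ^ n) → Fin n → Carrier
  decode k i = enum (finToFun k i)

  code : (Fin n → Carrier) → Fin (q ^ n)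
  code c = funToFin (index ∘ c)

  decode-code : (c : Fin n → Carrier) → ∀ i → decode (code c) i ≈ c i
  decode-code c i = ≈-trans (≈-reflexive (≡.cong enum (finToFun-funToFin (index ∘ c) i))) (enum-index (c i))

  code-injective : {c c' : Fin n → Carrier} → code c ≡ code c' → ∀ i → c i ≈ c' i
  code-injective {c = c} {c'} eq i =
    ≈-trans (≈-sym (decode-code c i)) (≈-trans (≈-reflexive (≡.cong (λ k → decode k i) eq)) (decode-code c' i))

  decode-injective : ∀ {n} {k k' : Fin (q ^ n)} → (∀ i → decode {n} k i ≈ decode k' i) → k ≡ k'
  decode-injective {n} {k} {k'} eq =
    ≡.trans (≡.sym (funToFin-finToFin {n} {q} k))
      (≡.trans (funToFin-cong {n} (λ i → enum-inj _ _ (eq i))) (funToFin-finToFin {n} {q} k'))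

  -- a - b vanishes exactly when a ≈ b (with a - b written a + (-1) b).
  difference≈0⇒≈ : ∀ {a b} → a + (- 1#) * b ≈ 0# → a ≈ b
  difference≈0⇒≈ {a} {b} h = x∙y⁻¹≈ε⇒x≈y a b (≈-trans (+-congˡ (≈-sym (-1*x≈-x b))) h)

  ≈⇒difference≈0 : ∀ {a b} → a ≈ b → a + (- 1#) * b ≈ 0#
  ≈⇒difference≈0 {a} {b} h = ≈-trans (+-congˡ (-1*x≈-x b)) (x≈y⇒x∙y⁻¹≈ε h)

  -- More columns than rows force a non-coloop: two of the q ^ n coefficient
  -- vectors have the same image in F^r (pigeonhole), and their difference is a
  -- nontrivial relation.
  nonColoop-exists : r < n → (A : Matrix F r n) → Σ (Fin n) (NonColoop A)
  nonColoop-exists {r} {n} r<n A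
    with k , k' , k<k' , same ← pigeonhole (^-monoʳ-< q 1<q r<n) (λ k → code (lincomb F A (decode k)))
    with x , differ ← ¬∀⟶∃¬ n _ (λ i → decode k i ≈? decode k' i) (<⇒≢ k<k' ∘ decode-injective)
    = x , (λ i → decode k i + (- 1#) * decode k' i) , differ ∘ difference≈0⇒≈ , relation
    where
    relation : ∀ j → lincomb F A (λ i → decode k i + (- 1#) * decode k' i) j ≈ 0#
    relation j = ≈-trans (lincomb-+* A (decode k) (- 1#) (decode k') j)
                         (≈⇒difference≈0 (code-injective same j))

  -- Being a non-coloop is decidable: search all q ^ n coefficient vectors.
  nonColoop? : (A : Matrix F r n) (e : Fin n) → Dec (NonColoop A e)
  nonColoop? A e with any? (λ k → ¬? (decode k e ≈? 0#) ×-dec all? (λ j → lincomb F A (decode k) j ≈? 0#))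
  ... | yes (k , ke≉0 , relation) = yes (decode k , ke≉0 , relation)
  ... | no none = no λ (c , ce≉0 , relation) → none (code c ,
          (ce≉0 ∘ ≈-trans (≈-sym (decode-code c e))) ,
          λ j → ≈-trans (lincomb-cong A (decode-code c) j) (relation j))

-- The arithmetic on ℕ is opened only from here on: inside LinearAlgebra its
-- _+_ and _*_ would clash with the operations of the field.
open import Data.Nat using (ℕ; zero; suc; _+_; _*_; _≤_; _<_; _∸_; s≤s)
open import Data.Nat.Properties using (≤-refl; ≤-trans; +-mono-≤; m≤n+m; m∸n≤m; m∸n+n≡m; module ≤-Reasoning)
open import Data.Nat.Combinatorics using (_C_)
open import Data.Fin using (Fin; zero; suc)
open import Data.Fin.Subset using (Subset; outside; _∈_; _∉_; ∣_∣)
open import Data.Fin.Subset.Properties using (_∈?_)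
open import Data.Vec using (insertAt; removeAt)
open import Data.Vec.Properties using (removeAt-insertAt)
open import Data.List using (List; length; filter; map; allFin)
open import Data.List.Properties using (length-map)
open import Data.List.Membership.Propositional using () renaming (_∈_ to _∈ₗ_)
open import Data.List.Membership.Propositional.Properties using (∈-filter⁺; ∈-filter⁻; ∈-map⁺; ∈-map⁻; ∈-allFin)
import Data.List.Relation.Unary.All as All
open import Data.List.Relation.Unary.Unique.Propositional using (Unique)
open import Data.List.Relation.Unary.Unique.Propositional.Properties using (filter⁺)
open import Data.List.Extrema.Nat using (argmax; f[xs]≤f[argmax])
open import Data.Product using (Σ; _×_; _,_; proj₁; proj₂)
open import Function using (_∘_)
open import Function.Bundles using (_⇔_; mk⇔; Equivalence)
open import Relation.Nullary using (¬_; Dec; yes; no)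
open import Relation.Unary.Properties using (∁?)
open import Relation.Binary.PropositionalEquality using (_≡_; _≢_; refl; sym; trans; cong; subst)

module DeletionStep {q : ℕ} (F : FiniteField q) {r n m : ℕ} (B : Matrix F r (suc n))
  (L : List (Subset (suc n))) (unique : Unique L)
  (members : ∀ S → (S ∈ₗ L) ⇔ ((∣ S ∣ ≡ m) × Dependent F B S)) where

  open LinearAlgebra F

  containing : Fin (suc n) → ℕ
  containing e = length (filter (e ∈?_) L)

  ∈L⇒ : ∀ {S} → S ∈ₗ L → (∣ S ∣ ≡ m) × Dependent F B S
  ∈L⇒ {S} = Equivalence.to (members S)

  ⇒∈L : ∀ {S} → (∣ S ∣ ≡ m) × Dependent F B S → S ∈ₗ L
  ⇒∈L {S} = Equivalence.from (members S)

  -- A coloop e lies in no more dependent m-sets than any other column f: the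
  -- sets containing e but not f inject, by exchanging e for f, into the sets
  -- containing f but not e.
  coloop-containing-≤ : ∀ {e f} → e ≢ f → ¬ NonColoop B e → containing e ≤ containing f
  coloop-containing-≤ {e} {f} e≢f coloop = begin
    containing e
      ≡⟨ length-filter-split (f ∈?_) (filter (e ∈?_) L) ⟨
    length (filter (f ∈?_) (filter (e ∈?_) L)) + length Xs
      ≤⟨ +-mono-≤ (length-filter-filter-≤ (e ∈?_) (f ∈?_) L unique) exchange-≤ ⟩
    length (filter (e ∈?_) (filter (f ∈?_) L)) + length Ys
      ≡⟨ length-filter-split (e ∈?_) (filter (f ∈?_) L) ⟩
    containing f
      ∎
    where
    open ≤-Reasoning
    Xs = filter (∁? (f ∈?_)) (filter (e ∈?_) L)
    Ys = filter (∁? (e ∈?_)) (filter (f ∈?_) L)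
    from-Xs : ∀ {S} → S ∈ₗ Xs → S ∈ₗ L × e ∈ S × f ∉ S
    from-Xs {S} S∈ with S∈' , f∉S ← ∈-filter⁻ (∁? (f ∈?_)) {xs = filter (e ∈?_) L} S∈
                   with S∈L , e∈S ← ∈-filter⁻ (e ∈?_) {xs = L} S∈' = S∈L , e∈S , f∉S
    into : ∀ {S} → S ∈ₗ Xs → exchange e f S ∈ₗ Ys
    into S∈ with S∈L , e∈S , f∉S ← from-Xs S∈ with size , dependent ← ∈L⇒ S∈L =
      ∈-filter⁺ (∁? (e ∈?_)) {xs = filter (f ∈?_) L}
        (∈-filter⁺ (f ∈?_) {xs = L}
          (⇒∈L (trans (∣exchange∣ e≢f e∈S f∉S) size , dependent-exchange B coloop e≢f dependent))
          (f∈exchange e≢f))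
        (e∉exchange e≢f)
    exchange-≤ : length Xs ≤ length Ys
    exchange-≤ = length-≤-injection (exchange e f) Xs Ys (filter⁺ _ (filter⁺ _ unique)) into injective
      where
      injective : ∀ {S S'} → S ∈ₗ Xs → S' ∈ₗ Xs → exchange e f S ≡ exchange e f S' → S ≡ S'
      injective S∈ S'∈ with _ , e∈S , f∉S ← from-Xs S∈ | _ , e∈S' , f∉S' ← from-Xs S'∈ =
        exchange-injective e≢f e∈S e∈S' f∉S f∉S'

  heaviest : Fin (suc n)
  heaviest = argmax containing zero (allFin (suc n))

  heaviest-maximal : ∀ x → containing x ≤ containing heaviest
  heaviest-maximal x = All.lookup (f[xs]≤f[argmax] {f = containing} zero (allFin (suc n))) (∈-allFin x)

  HeavyNonColoop : Fin (suc n) → Set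
  HeavyNonColoop e = NonColoop B e × (∀ x → containing x ≤ containing e)

  -- It exists when B has more columns than rows: if the heaviest column is a
  -- coloop, any non-coloop is at least as heavy.
  heavyNonColoop-exists : r < suc n → Σ (Fin (suc n)) HeavyNonColoop
  heavyNonColoop-exists r<n+1 = choose (nonColoop? B heaviest) (nonColoop-exists r<n+1 B)
    where
    choose : Dec (NonColoop B heaviest) → Σ (Fin (suc n)) (NonColoop B) → Σ (Fin (suc n)) HeavyNonColoop
    choose (yes nonColoop) _                 = heaviest , nonColoop , heaviest-maximal
    choose (no coloop)     (e₀ , nonColoop₀) =
      e₀ , nonColoop₀ , λ x → ≤-trans (heaviest-maximal x) (coloop-containing-≤ heaviest≢e₀ coloop)
      where
      heaviest≢e₀ : heaviest ≢ e₀
      heaviest≢e₀ refl = coloop nonColoop₀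

  module _ (e : Fin (suc n)) where

    avoiding : List (Subset (suc n))
    avoiding = filter (∁? (e ∈?_)) L

    restricted : List (Subset n)
    restricted = map (λ S → removeAt S e) avoiding

    from-avoiding : ∀ {S} → S ∈ₗ avoiding → S ∈ₗ L × e ∉ S
    from-avoiding = ∈-filter⁻ (∁? (e ∈?_)) {xs = L}

    restricted-members : ∀ S' → (S' ∈ₗ restricted) ⇔ ((∣ S' ∣ ≡ m) × Dependent F (deleteColumn B e) S')
    restricted-members S' = mk⇔ to from
      where
      to : S' ∈ₗ restricted → (∣ S' ∣ ≡ m) × Dependent F (deleteColumn B e) S'
      to S'∈ with S , S∈ , refl ← ∈-map⁻ (λ S → removeAt S e) S'∈
             with S∈L , e∉S ← from-avoiding S∈
             with size , dependent ← ∈L⇒ S∈L =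
        trans (sym (∣insertAt-outside∣ (removeAt S e) e)) (trans (cong ∣_∣ restore) size) ,
        dependent-deleteColumn⁺ B e (removeAt S e) (subst (Dependent F B) (sym restore) dependent)
        where
        restore : insertAt (removeAt S e) e outside ≡ S
        restore = insertAt-removeAt-∉ e∉S
      from : (∣ S' ∣ ≡ m) × Dependent F (deleteColumn B e) S' → S' ∈ₗ restricted
      from (size , dependent) =
        subst (_∈ₗ restricted) (removeAt-insertAt S' e outside)
          (∈-map⁺ (λ S → removeAt S e)
            (∈-filter⁺ (∁? (e ∈?_)) {xs = L}
              (⇒∈L (trans (∣insertAt-outside∣ S' e) size , dependent-deleteColumn⁻ B e S' dependent))
              ∉-insertAt))

    restricted-unique : Unique restricted
    restricted-unique = unique-map _ avoiding (filter⁺ _ unique) λ S∈ S'∈ eq →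
      trans (sym (insertAt-removeAt-∉ (proj₂ (from-avoiding S∈))))
        (trans (cong (λ V → insertAt V e outside) eq) (insertAt-removeAt-∉ (proj₂ (from-avoiding S'∈))))

    dependents-after-deletion : NumDependent F (deleteColumn B e) m (length avoiding)
    dependents-after-deletion = restricted , restricted-unique , restricted-members , length-map _ avoiding

  -- Deleting column e keeps full rank and does not increase the k-dependence:
  -- the N' dependent m-sets left satisfy N'/C(n,m) ≤ N/C(n+1,m).
  GoodDeletion : Fin (suc n) → Set
  GoodDeletion e = FullRank F (deleteColumn B e) ×
    Σ ℕ λ N' → NumDependent F (deleteColumn B e) m N' × (N' * (suc n C m) ≤ length L * (n C m))

  -- Deleting a heavy non-coloop is good: the deletion keeps the column space,
  -- and the column lies in at least the average share m/(n+1) of the sets.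
  heavyNonColoop-deletion : FullRank F B → ∀ e → HeavyNonColoop e → GoodDeletion e
  heavyNonColoop-deletion fullRank e (nonColoop , maximal) =
    fullRank-deleteColumn B e fullRank nonColoop , length (avoiding e) , dependents-after-deletion e ,
    subst (λ N → length (avoiding e) * (suc n C m) ≤ N * (n C m)) split
      (deletion-ratio n m (containing e) (length (avoiding e))
        (subst (λ N → N * m ≤ suc n * containing e) (sym split) share))
    where
    split : containing e + length (avoiding e) ≡ length L
    split = length-filter-split (e ∈?_) L
    -- Each of the length L sets has m elements, so the columns' counts sum to
    -- length L * m, and the count of e is at least the average.
    share : length L * m ≤ suc n * containing e
    share = subst (_≤ suc n * containing e) (double-counting L (proj₁ ∘ ∈L⇒)) (sum-≤ containing maximal)

  good-deletion-exists : r ≤ n → FullRank F B → Σ (Fin (suc n)) GoodDeletion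
  good-deletion-exists r≤n fullRank =
    let e , heavy = heavyNonColoop-exists (s≤s r≤n) in e , heavyNonColoop-deletion fullRank e heavy

delete-columns : ∀ {q} (F : FiniteField q) {r m s} (d : ℕ) → r ≤ s → m ≤ s →
  (B : Matrix F r (d + s)) → FullRank F B → (NB : ℕ) → NumDependent F B m NB →
  Σ (Matrix F r s) λ A → FullRank F A × Σ ℕ λ NA → NumDependent F A m NA ×
    (NA * ((d + s) C m) ≤ NB * (s C m))
delete-columns F zero    r≤s m≤s B fullRank NB dependents = B , fullRank , NB , dependents , ≤-refl
delete-columns F {m = m} {s = s} (suc d) r≤s m≤s B fullRank _ (L , unique , members , refl) =
  let e , fullRank' , N' , dependents' , ratio₁ =
        DeletionStep.good-deletion-exists F B L unique members (≤-trans r≤s (m≤n+m s d)) fullRank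
      A , fullRankA , NA , dependentsA , ratio₂ =
        delete-columns F d r≤s m≤s (LinearAlgebra.deleteColumn F B e) fullRank' N' dependents'
  in A , fullRankA , NA , dependentsA ,
     ratio-trans {NA} {N'} {length L} {s C m} {(d + s) C m} (C-positive (≤-trans m≤s (m≤n+m s d))) ratio₂ ratio₁

-- The theorem: write t = d + s and delete d columns.
lemma2 : (q : ℕ) → IsPrimePower q → (F : FiniteField q) →
    (r k : ℕ) → 1 ≤ r → k ≤ r → (s t : ℕ) → r ≤ s → s ≤ t →
    (B : Matrix F r t) → FullRank F B → (NB : ℕ) → NumDependent F B (r ∸ k) NB →
    Σ (Matrix F r s) λ A → FullRank F A × Σ ℕ λ NA → NumDependent F A (r ∸ k) NA ×
      (NA * (t C (r ∸ k)) ≤ NB * (s C (r ∸ k)))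
lemma2 q _ F r k _ _ s t r≤s s≤t with t ∸ s | m∸n+n≡m s≤t
... | d | refl = delete-columns F d r≤s (≤-trans (m∸n≤m r k) r≤s)
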